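{- Let $\mathbf{Hsh}$ be the real vector space spanned by all words (including the empty word $\emptyset$) on the two-letter alphabet $\{1,2\}$, equipped with the shuffle product (so $\emptyset$ is the unit). Let $R:\mathbf{Hsh}\to\mathbf{Hsh}$ be the linear map with $R(\underline\omega)=\underline\omega$ if the first letter of $\underline\omega$ is $1$ and $R(\underline\omega)=0$ otherwise (in particular $R(\emptyset)=0$). Then $(\mathbf{Hsh},R)$ is a unital commutative Rota–Baxter algebra of weight $-1$, i.e. $R(u)R(w)=R(R(u)w+uR(w)-uw)$ for all $u,w\in\mathbf{Hsh}$. -}

module Defs where

open import Level using (Level)
open import Data.Bool using (Bool; true; false; if_then_else_)
open import Data.Fin using (Fin; zero; suc)
open import Data.Fin.Properties using () renaming (_≟_ to _≟F_)
open import Data.List using (List; []; _∷_; _++_; map; concatMap)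
open import Data.List.Properties using (≡-dec)
open import Data.Product using (_×_; _,_)
open import Relation.Nullary.Decidable using (⌊_⌋)
open import Relation.Binary.PropositionalEquality using (_≡_)
open import Algebra.Bundles using (CommutativeRing)

-- The two-letter alphabet {1,2}: letter 1 is `zero`, letter 2 is `suc zero`.
Letter : Set
Letter = Fin 2

l1 l2 : Letter
l1 = zero
l2 = suc zero

Word : Set
Word = List Letter

_≟W_ : (u v : Word) → Relation.Nullary.Decidable.Dec (u ≡ v)
_≟W_ = ≡-dec _≟F_

-- Shuffle of two words, as a list (multiset) of words with multiplicity.
shuffle : Word → Word → List Word
shuffle [] v = v ∷ []
shuffle (a ∷ u) [] = (a ∷ u) ∷ []
shuffle (a ∷ u) (b ∷ v) =
  map (a ∷_) (shuffle u (b ∷ v)) ++ map (b ∷_) (shuffle (a ∷ u) v)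

startsWith1 : Word → Bool
startsWith1 [] = false
startsWith1 (zero ∷ _) = true
startsWith1 (suc _ ∷ _) = false

-- The free K-module on words (Hsh with coefficients in a commutative ring K),
-- with elements represented by finite formal sums and equality given by
-- equality of all coefficients.
module Hsh {c ℓ : Level} (K : CommutativeRing c ℓ) where
  open CommutativeRing K renaming (_+_ to _+K_; _*_ to _*K_; -_ to -K_)

  Elem : Set c
  Elem = List (Carrier × Word)

  coeff : Elem → Word → Carrier
  coeff [] w = 0#
  coeff ((a , v) ∷ u) w = (if ⌊ v ≟W w ⌋ then a else 0#) +K coeff u w

  infix 4 _≈H_
  _≈H_ : Elem → Elem → Set ℓ
  u ≈H v = ∀ w → coeff u w ≈ coeff v w

  ⟦_⟧ : Word → Elem
  ⟦ w ⟧ = (1# , w) ∷ []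

  𝟙 : Elem
  𝟙 = ⟦ [] ⟧

  infixl 6 _⊕_ _⊖_
  infixl 7 _⧢_

  _⊕_ : Elem → Elem → Elem
  u ⊕ v = u ++ v

  ⊖_ : Elem → Elem
  ⊖ u = map (λ { (a , w) → (-K a , w) }) u

  _⊖_ : Elem → Elem → Elem
  u ⊖ v = u ⊕ (⊖ v)

  _⧢_ : Elem → Elem → Elem
  u ⧢ v = concatMap (λ { (a , x) →
            concatMap (λ { (b , y) →
              map (λ z → (a *K b , z)) (shuffle x y) }) v }) u

  Rop : Elem → Elem
  Rop [] = []
  Rop ((a , w) ∷ u) = if startsWith1 w then (a , w) ∷ Rop u else Rop u

-- Shuffling words is associative and commutative up to a permutation of the resulting lists of
-- words, by induction on first letters; since permuting the terms of a formal sum does not change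
-- its coefficients, the bilinear extension is associative and commutative. Both sides of the
-- Rota–Baxter identity are additive in each argument, so it suffices to check it on two words x
-- and y. Every shuffle of x and y begins with the first letter of x or of y, so when both or
-- neither start with 1, R fixes or kills x ⧢ y; in all four cases the identity reduces to
-- u + v − v = u.
module Submission where

open import Level using (Level)
open import Function using (_∘_)
open import Data.Bool using (true; false; if_then_else_)
open import Data.Fin using (zero; suc)
open import Data.Product using (_×_; _,_; proj₂)
open import Data.List using (List; []; _∷_; [_]; _++_; map; concatMap; filterᵇ)
import Data.List.Properties as List
open import Data.List.Relation.Unary.All as All using (All; []; _∷_)
import Data.List.Relation.Unary.All.Properties as All
open import Data.List.Relation.Binary.Permutation.Propositional as ↭
  using (_↭_; ↭-refl; ↭-sym; ↭-trans; ↭-reflexive; module PermutationReasoning)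
open import Data.List.Relation.Binary.Permutation.Propositional.Properties
  using (++⁺ˡ; ++⁺ʳ; ++⁺; ++-comm; map⁺; shifts; filter-↭; ++-commutativeMonoid)
open import Relation.Binary.PropositionalEquality as ≡
  using (_≡_; refl; sym; trans; cong; cong₂; module ≡-Reasoning)
open import Relation.Binary.Bundles using (Setoid)
open import Relation.Nullary.Decidable using (⌊_⌋)
open import Algebra.Bundles using (CommutativeRing; CommutativeMonoid)
import Algebra.Properties.CommutativeSemigroup as CommutativeSemigroupProperties
import Algebra.Properties.Ring as RingProperties
import Relation.Binary.Reasoning.Setoid as SetoidReasoning

open import Defs

private variable
  ℓa ℓb ℓc : Level
  A : Set ℓa
  B : Set ℓb
  C : Set ℓc

++-interchange : (ws xs ys zs : List A) → (ws ++ xs) ++ (ys ++ zs) ↭ (ws ++ ys) ++ (xs ++ zs)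
++-interchange = CommutativeSemigroupProperties.interchange
  (CommutativeMonoid.commutativeSemigroup ++-commutativeMonoid)

concatMap-nil : (xs : List A) → concatMap {B = B} (λ _ → []) xs ≡ []
concatMap-nil []       = refl
concatMap-nil (_ ∷ xs) = concatMap-nil xs

concatMap-concatMap : (f : B → List C) (g : A → List B) (xs : List A) →
  concatMap f (concatMap g xs) ≡ concatMap (concatMap f ∘ g) xs
concatMap-concatMap f g []       = refl
concatMap-concatMap f g (x ∷ xs) =
  trans (List.concatMap-++ f (g x) _) (cong (concatMap f (g x) ++_) (concatMap-concatMap f g xs))

concatMap-↭ : (f : A → List B) {xs ys : List A} → xs ↭ ys → concatMap f xs ↭ concatMap f ys
concatMap-↭ f ↭.refl          = ↭-refl
concatMap-↭ f (↭.prep x p)    = ++⁺ˡ (f x) (concatMap-↭ f p)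
concatMap-↭ f (↭.swap x y p)  =
  ↭-trans (shifts (f x) (f y)) (++⁺ˡ (f y) (++⁺ˡ (f x) (concatMap-↭ f p)))
concatMap-↭ f (↭.trans p q)   = ↭-trans (concatMap-↭ f p) (concatMap-↭ f q)

concatMap-cong-↭ : {f g : A → List B} → (∀ x → f x ↭ g x) → (xs : List A) →
  concatMap f xs ↭ concatMap g xs
concatMap-cong-↭ f↭g []       = ↭-refl
concatMap-cong-↭ f↭g (x ∷ xs) = ++⁺ (f↭g x) (concatMap-cong-↭ f↭g xs)

concatMap-++-pointwise : (f g : A → List B) (xs : List A) →
  concatMap (λ x → f x ++ g x) xs ↭ concatMap f xs ++ concatMap g xs
concatMap-++-pointwise f g []       = ↭-refl
concatMap-++-pointwise f g (x ∷ xs) =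
  ↭-trans (++⁺ˡ (f x ++ g x) (concatMap-++-pointwise f g xs)) (++-interchange (f x) (g x) _ _)

concatMap-comm : (g : A → B → List C) (xs : List A) (ys : List B) →
  concatMap (λ x → concatMap (g x) ys) xs ↭ concatMap (λ y → concatMap (λ x → g x y) xs) ys
concatMap-comm g []       ys = ↭-reflexive (sym (concatMap-nil ys))
concatMap-comm g (x ∷ xs) ys =
  ↭-trans (++⁺ˡ (concatMap (g x) ys) (concatMap-comm g xs ys))
          (↭-sym (concatMap-++-pointwise (g x) _ ys))

shuffle-identityʳ : ∀ x → shuffle x [] ≡ x ∷ []
shuffle-identityʳ []      = refl
shuffle-identityʳ (_ ∷ _) = refl

shuffle-comm : ∀ x y → shuffle x y ↭ shuffle y x
shuffle-comm []      y       = ↭-reflexive (sym (shuffle-identityʳ y))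
shuffle-comm (a ∷ x) []      = ↭-refl
shuffle-comm (a ∷ x) (b ∷ y) =
  ↭-trans (++⁺ (map⁺ (a ∷_) (shuffle-comm x (b ∷ y))) (map⁺ (b ∷_) (shuffle-comm (a ∷ x) y)))
          (++-comm (map (a ∷_) (shuffle (b ∷ y) x)) _)

infixl 7 _⧢ₗ_
infixr 7 _⧢ᵣ_

_⧢ₗ_ : List Word → Word → List Word
ws ⧢ₗ z = concatMap (λ t → shuffle t z) ws

_⧢ᵣ_ : Word → List Word → List Word
x ⧢ᵣ ws = concatMap (shuffle x) ws

map-∷-⧢ₗ : ∀ a c z ws →
  map (a ∷_) ws ⧢ₗ (c ∷ z) ↭ map (a ∷_) (ws ⧢ₗ (c ∷ z)) ++ map (c ∷_) (map (a ∷_) ws ⧢ₗ z)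
map-∷-⧢ₗ a c z ws = begin
  map (a ∷_) ws ⧢ₗ (c ∷ z)
    ≡⟨ List.concatMap-map _ (a ∷_) ws ⟩
  concatMap (λ t → map (a ∷_) (shuffle t (c ∷ z)) ++ map (c ∷_) (shuffle (a ∷ t) z)) ws
    ↭⟨ concatMap-++-pointwise _ _ ws ⟩
  concatMap (map (a ∷_) ∘ λ t → shuffle t (c ∷ z)) ws ++ concatMap (map (c ∷_) ∘ λ t → shuffle (a ∷ t) z) ws
    ≡⟨ cong₂ _++_ (List.map-concatMap (a ∷_) _ ws) (List.map-concatMap (c ∷_) _ ws) ⟨
  map (a ∷_) (ws ⧢ₗ (c ∷ z)) ++ map (c ∷_) (concatMap (λ t → shuffle (a ∷ t) z) ws)
    ≡⟨ cong (λ vs → map (a ∷_) (ws ⧢ₗ (c ∷ z)) ++ map (c ∷_) vs) (List.concatMap-map _ (a ∷_) ws) ⟨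
  map (a ∷_) (ws ⧢ₗ (c ∷ z)) ++ map (c ∷_) (map (a ∷_) ws ⧢ₗ z) ∎
  where open PermutationReasoning

∷-⧢ᵣ-map : ∀ a x b ws →
  (a ∷ x) ⧢ᵣ map (b ∷_) ws ↭ map (a ∷_) (x ⧢ᵣ map (b ∷_) ws) ++ map (b ∷_) ((a ∷ x) ⧢ᵣ ws)
∷-⧢ᵣ-map a x b ws = begin
  (a ∷ x) ⧢ᵣ map (b ∷_) ws
    ≡⟨ List.concatMap-map _ (b ∷_) ws ⟩
  concatMap (λ t → map (a ∷_) (shuffle x (b ∷ t)) ++ map (b ∷_) (shuffle (a ∷ x) t)) ws
    ↭⟨ concatMap-++-pointwise _ _ ws ⟩
  concatMap (map (a ∷_) ∘ λ t → shuffle x (b ∷ t)) ws ++ concatMap (map (b ∷_) ∘ shuffle (a ∷ x)) ws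
    ≡⟨ cong₂ _++_ (List.map-concatMap (a ∷_) _ ws) (List.map-concatMap (b ∷_) _ ws) ⟨
  map (a ∷_) (concatMap (λ t → shuffle x (b ∷ t)) ws) ++ map (b ∷_) ((a ∷ x) ⧢ᵣ ws)
    ≡⟨ cong (λ vs → map (a ∷_) vs ++ map (b ∷_) ((a ∷ x) ⧢ᵣ ws)) (List.concatMap-map _ (b ∷_) ws) ⟨
  map (a ∷_) (x ⧢ᵣ map (b ∷_) ws) ++ map (b ∷_) ((a ∷ x) ⧢ᵣ ws) ∎
  where open PermutationReasoning

shuffle-∷-∷-⧢ₗ-∷ : ∀ a x b y c z →
  shuffle (a ∷ x) (b ∷ y) ⧢ₗ (c ∷ z) ↭
    (map (a ∷_) (shuffle x (b ∷ y) ⧢ₗ (c ∷ z)) ++ map (b ∷_) (shuffle (a ∷ x) y ⧢ₗ (c ∷ z)))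
    ++ map (c ∷_) (shuffle (a ∷ x) (b ∷ y) ⧢ₗ z)
shuffle-∷-∷-⧢ₗ-∷ a x b y c z = begin
  (as ++ bs) ⧢ₗ (c ∷ z)                  ≡⟨ List.concatMap-++ (λ t → shuffle t (c ∷ z)) as bs ⟩
  as ⧢ₗ (c ∷ z) ++ bs ⧢ₗ (c ∷ z)         ↭⟨ ++⁺ (map-∷-⧢ₗ a c z xs) (map-∷-⧢ₗ b c z ys) ⟩
  (a′ ++ c₁) ++ (b′ ++ c₂)                ↭⟨ ++-interchange a′ c₁ b′ c₂ ⟩
  (a′ ++ b′) ++ (c₁ ++ c₂)                ≡⟨ cong ((a′ ++ b′) ++_) c-part ⟨
  (a′ ++ b′) ++ map (c ∷_) ((as ++ bs) ⧢ₗ z) ∎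
  where
  open PermutationReasoning
  xs = shuffle x (b ∷ y)
  ys = shuffle (a ∷ x) y
  as = map (a ∷_) xs
  bs = map (b ∷_) ys
  a′ = map (a ∷_) (xs ⧢ₗ (c ∷ z))
  b′ = map (b ∷_) (ys ⧢ₗ (c ∷ z))
  c₁ = map (c ∷_) (as ⧢ₗ z)
  c₂ = map (c ∷_) (bs ⧢ₗ z)
  c-part : map (c ∷_) ((as ++ bs) ⧢ₗ z) ≡ c₁ ++ c₂
  c-part = trans (cong (map (c ∷_)) (List.concatMap-++ (λ t → shuffle t z) as bs))
                 (List.map-++ (c ∷_) (as ⧢ₗ z) (bs ⧢ₗ z))

∷-⧢ᵣ-shuffle-∷-∷ : ∀ a x b y c z →
  (a ∷ x) ⧢ᵣ shuffle (b ∷ y) (c ∷ z) ↭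
    (map (a ∷_) (x ⧢ᵣ shuffle (b ∷ y) (c ∷ z)) ++ map (b ∷_) ((a ∷ x) ⧢ᵣ shuffle y (c ∷ z)))
    ++ map (c ∷_) ((a ∷ x) ⧢ᵣ shuffle (b ∷ y) z)
∷-⧢ᵣ-shuffle-∷-∷ a x b y c z = begin
  (a ∷ x) ⧢ᵣ (bs ++ cs)                  ≡⟨ List.concatMap-++ (shuffle (a ∷ x)) bs cs ⟩
  (a ∷ x) ⧢ᵣ bs ++ (a ∷ x) ⧢ᵣ cs         ↭⟨ ++⁺ (∷-⧢ᵣ-map a x b ys) (∷-⧢ᵣ-map a x c zs) ⟩
  (a₁ ++ b′) ++ (a₂ ++ c′)                ↭⟨ ++-interchange a₁ b′ a₂ c′ ⟩
  (a₁ ++ a₂) ++ (b′ ++ c′)                ≡⟨ cong (_++ (b′ ++ c′)) a-part ⟨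
  map (a ∷_) (x ⧢ᵣ (bs ++ cs)) ++ (b′ ++ c′) ≡⟨ List.++-assoc _ b′ c′ ⟨
  (map (a ∷_) (x ⧢ᵣ (bs ++ cs)) ++ b′) ++ c′ ∎
  where
  open PermutationReasoning
  ys = shuffle y (c ∷ z)
  zs = shuffle (b ∷ y) z
  bs = map (b ∷_) ys
  cs = map (c ∷_) zs
  a₁ = map (a ∷_) (x ⧢ᵣ bs)
  a₂ = map (a ∷_) (x ⧢ᵣ cs)
  b′ = map (b ∷_) ((a ∷ x) ⧢ᵣ ys)
  c′ = map (c ∷_) ((a ∷ x) ⧢ᵣ zs)
  a-part : map (a ∷_) (x ⧢ᵣ (bs ++ cs)) ≡ a₁ ++ a₂
  a-part = trans (cong (map (a ∷_)) (List.concatMap-++ (shuffle x) bs cs))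
                 (List.map-++ (a ∷_) (x ⧢ᵣ bs) (x ⧢ᵣ cs))

shuffle-assoc : ∀ x y z → shuffle x y ⧢ₗ z ↭ x ⧢ᵣ shuffle y z
shuffle-assoc []      y       z       =
  ↭-reflexive (trans (List.++-identityʳ (shuffle y z)) (sym (List.concatMap-pure (shuffle y z))))
shuffle-assoc (a ∷ x) []      z       = ↭-refl
shuffle-assoc (a ∷ x) (b ∷ y) []      = ↭-reflexive (begin
  concatMap (λ t → shuffle t []) (shuffle (a ∷ x) (b ∷ y))
    ≡⟨ List.concatMap-cong shuffle-identityʳ (shuffle (a ∷ x) (b ∷ y)) ⟩
  concatMap (_∷ []) (shuffle (a ∷ x) (b ∷ y))
    ≡⟨ List.concatMap-pure (shuffle (a ∷ x) (b ∷ y)) ⟩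
  shuffle (a ∷ x) (b ∷ y)
    ≡⟨ List.++-identityʳ _ ⟨
  (a ∷ x) ⧢ᵣ shuffle (b ∷ y) [] ∎)
  where open ≡-Reasoning
shuffle-assoc (a ∷ x) (b ∷ y) (c ∷ z) =
  ↭-trans (shuffle-∷-∷-⧢ₗ-∷ a x b y c z)
  (↭-trans (++⁺ (++⁺ (map⁺ (a ∷_) (shuffle-assoc x (b ∷ y) (c ∷ z)))
                     (map⁺ (b ∷_) (shuffle-assoc (a ∷ x) y (c ∷ z))))
                (map⁺ (c ∷_) (shuffle-assoc (a ∷ x) (b ∷ y) z)))
           (↭-sym (∷-⧢ᵣ-shuffle-∷-∷ a x b y c z)))

startsWith1-∷ : ∀ a t t′ → startsWith1 (a ∷ t) ≡ startsWith1 (a ∷ t′)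
startsWith1-∷ zero    _ _ = refl
startsWith1-∷ (suc _) _ _ = refl

shuffle-startsWith1 : ∀ {b} x y → startsWith1 x ≡ b → startsWith1 y ≡ b →
  All (λ z → startsWith1 z ≡ b) (shuffle x y)
shuffle-startsWith1 []      y       _  y≡b = y≡b ∷ []
shuffle-startsWith1 (a ∷ x) []      x≡b _  = x≡b ∷ []
shuffle-startsWith1 (a ∷ x) (c ∷ y) x≡b y≡b = All.++⁺
  (All.map⁺ (All.universal (λ t → trans (startsWith1-∷ a t x) x≡b) (shuffle x (c ∷ y))))
  (All.map⁺ (All.universal (λ t → trans (startsWith1-∷ c t y) y≡b) (shuffle (a ∷ x) y)))

module _ {c ℓ : Level} (K : CommutativeRing c ℓ) where

  open CommutativeRing K renaming (refl to ≈-refl; sym to ≈-sym; trans to ≈-trans)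
  open Hsh K
  open CommutativeSemigroupProperties (CommutativeMonoid.commutativeSemigroup +-commutativeMonoid)
    using (x∙yz≈y∙xz)
  open RingProperties ring using (-0#≈0#; -‿+-comm)

  -- A record rather than _≈H_ itself, so that Agda can infer the two sums from a proof.
  infix 4 _≋_
  record _≋_ (u v : Elem) : Set ℓ where
    constructor ≈H⇒≋
    field ≋⇒≈H : u ≈H v
  open _≋_ public

  ≋-refl : ∀ {u} → u ≋ u
  ≋-refl = ≈H⇒≋ λ _ → ≈-refl

  ≋-sym : ∀ {u v} → u ≋ v → v ≋ u
  ≋-sym (≈H⇒≋ u≈v) = ≈H⇒≋ λ w → ≈-sym (u≈v w)

  ≋-trans : ∀ {u v x} → u ≋ v → v ≋ x → u ≋ x
  ≋-trans (≈H⇒≋ u≈v) (≈H⇒≋ v≈x) = ≈H⇒≋ λ w → ≈-trans (u≈v w) (v≈x w)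

  ≋-setoid : Setoid c ℓ
  ≋-setoid = record
    { Carrier       = Elem
    ; _≈_           = _≋_
    ; isEquivalence = record { refl = ≋-refl ; sym = ≋-sym ; trans = ≋-trans }
    }

  open SetoidReasoning ≋-setoid

  coeff-⊕ : ∀ u v w → coeff (u ⊕ v) w ≈ coeff u w + coeff v w
  coeff-⊕ []      v w = ≈-sym (+-identityˡ _)
  coeff-⊕ (_ ∷ u) v w = ≈-trans (+-congˡ (coeff-⊕ u v w)) (≈-sym (+-assoc _ _ _))

  coeff-⊖ : ∀ u w → coeff (⊖ u) w ≈ - coeff u w
  coeff-⊖ []            w = ≈-sym -0#≈0#
  coeff-⊖ ((a , v) ∷ u) w with ⌊ v ≟W w ⌋
  ... | true  = ≈-trans (+-congˡ (coeff-⊖ u w)) (-‿+-comm a (coeff u w))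
  ... | false = ≈-trans (+-cong (≈-sym -0#≈0#) (coeff-⊖ u w)) (-‿+-comm 0# (coeff u w))

  ↭⇒≋ : ∀ {u v} → u ↭ v → u ≋ v
  ↭⇒≋ u↭v = ≈H⇒≋ (coeff-↭ u↭v)
    where
    coeff-↭ : ∀ {u v} → u ↭ v → u ≈H v
    coeff-↭ ↭.refl            w = ≈-refl
    coeff-↭ (↭.prep _ u↭v)    w = +-congˡ (coeff-↭ u↭v w)
    coeff-↭ (↭.swap _ _ u↭v)  w = ≈-trans (x∙yz≈y∙xz _ _ _) (+-congˡ (+-congˡ (coeff-↭ u↭v w)))
    coeff-↭ (↭.trans u↭v v↭x) w = ≈-trans (coeff-↭ u↭v w) (coeff-↭ v↭x w)

  ⊕-cong : ∀ {u u′ v v′} → u ≋ u′ → v ≋ v′ → u ⊕ v ≋ u′ ⊕ v′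
  ⊕-cong {u} {u′} {v} {v′} (≈H⇒≋ u≈u′) (≈H⇒≋ v≈v′) = ≈H⇒≋ λ w →
    ≈-trans (coeff-⊕ u v w) (≈-trans (+-cong (u≈u′ w) (v≈v′ w)) (≈-sym (coeff-⊕ u′ v′ w)))

  ⊖-inverseʳ : ∀ u → u ⊖ u ≋ []
  ⊖-inverseʳ u = ≈H⇒≋ λ w →
    ≈-trans (coeff-⊕ u (⊖ u) w) (≈-trans (+-congˡ (coeff-⊖ u w)) (-‿inverseʳ (coeff u w)))

  ⊕-⊖-cancelʳ : ∀ u v → u ⊕ v ⊖ v ≋ u
  ⊕-⊖-cancelʳ u v = begin
    u ⊕ v ⊖ v    ≡⟨ List.++-assoc u v (⊖ v) ⟩
    u ⊕ (v ⊖ v)  ≈⟨ ⊕-cong ≋-refl (⊖-inverseʳ v) ⟩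
    u ⊕ []       ≡⟨ List.++-identityʳ u ⟩
    u            ∎

  ⊕-⊖-cancelˡ : ∀ u v → u ⊕ v ⊖ u ≋ v
  ⊕-⊖-cancelˡ u v = ≋-trans (↭⇒≋ (++⁺ʳ (⊖ u) (++-comm u v))) (⊕-⊖-cancelʳ v u)

  concatMap-cong-≋ : {f g : A → Elem} → (∀ x → f x ≋ g x) →
    ∀ xs → concatMap f xs ≋ concatMap g xs
  concatMap-cong-≋ f≋g []       = ≋-refl
  concatMap-cong-≋ f≋g (x ∷ xs) = ⊕-cong (f≋g x) (concatMap-cong-≋ f≋g xs)

  infixr 8 _•_
  _•_ : Carrier → List Word → Elem
  k • ws = map (k ,_) ws

  •-congˡ : ∀ {k k′} → k ≈ k′ → ∀ ws → k • ws ≋ k′ • ws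
  •-congˡ {k} {k′} k≈k′ ws = ≈H⇒≋ (coeff-• ws)
    where
    coeff-• : ∀ ws → k • ws ≈H k′ • ws
    coeff-• []       w = ≈-refl
    coeff-• (z ∷ ws) w with ⌊ z ≟W w ⌋
    ... | true  = +-cong k≈k′ (coeff-• ws w)
    ... | false = +-congˡ (coeff-• ws w)

  •-concatMap : ∀ k (f : Word → List Word) ws → concatMap (λ z → k • f z) ws ≡ k • concatMap f ws
  •-concatMap k f ws = ≡.sym (List.map-concatMap (k ,_) f ws)

  -- With this, u ⧢ v unfolds to concatMap (λ p → concatMap (p ·_) v) u.
  infixl 7 _·_
  _·_ : Carrier × Word → Carrier × Word → Elem
  (a , x) · (b , y) = (a * b) • shuffle x y

  ·-comm : ∀ p q → p · q ≋ q · p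
  ·-comm (a , x) (b , y) =
    ≋-trans (•-congˡ (*-comm a b) (shuffle x y)) (↭⇒≋ (map⁺ (b * a ,_) (shuffle-comm x y)))

  ·-assoc : ∀ p q r → concatMap (_· r) (p · q) ≋ concatMap (p ·_) (q · r)
  ·-assoc (a , x) (b , y) (c′ , z) = begin
    concatMap (_· (c′ , z)) ((a * b) • shuffle x y)
      ≡⟨ List.concatMap-map _ _ (shuffle x y) ⟩
    concatMap (λ t → (a * b * c′) • shuffle t z) (shuffle x y)
      ≡⟨ •-concatMap _ (λ t → shuffle t z) (shuffle x y) ⟩
    (a * b * c′) • (shuffle x y ⧢ₗ z)
      ≈⟨ •-congˡ (*-assoc a b c′) _ ⟩
    (a * (b * c′)) • (shuffle x y ⧢ₗ z)
      ≈⟨ ↭⇒≋ (map⁺ _ (shuffle-assoc x y z)) ⟩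
    (a * (b * c′)) • (x ⧢ᵣ shuffle y z)
      ≡⟨ •-concatMap _ (shuffle x) (shuffle y z) ⟨
    concatMap (λ t → (a * (b * c′)) • shuffle x t) (shuffle y z)
      ≡⟨ List.concatMap-map _ _ (shuffle y z) ⟨
    concatMap ((a , x) ·_) ((b * c′) • shuffle y z) ∎

  ⧢-comm : ∀ u v → u ⧢ v ≋ v ⧢ u
  ⧢-comm u v = ≋-trans (↭⇒≋ (concatMap-comm _·_ u v))
    (concatMap-cong-≋ (λ q → concatMap-cong-≋ (λ p → ·-comm p q) u) v)

  ·-⧢-assoc : ∀ p q w → (p · q) ⧢ w ≋ concatMap (p ·_) (concatMap (q ·_) w)
  ·-⧢-assoc p q w = begin
    (p · q) ⧢ w                                        ≈⟨ ↭⇒≋ (concatMap-comm _·_ (p · q) w) ⟩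
    concatMap (λ r → concatMap (_· r) (p · q)) w       ≈⟨ concatMap-cong-≋ (·-assoc p q) w ⟩
    concatMap (λ r → concatMap (p ·_) (q · r)) w       ≡⟨ concatMap-concatMap (p ·_) (q ·_) w ⟨
    concatMap (p ·_) (concatMap (q ·_) w)              ∎

  ⧢-assoc : ∀ u v w → u ⧢ v ⧢ w ≋ u ⧢ (v ⧢ w)
  ⧢-assoc u v w = begin
    u ⧢ v ⧢ w
      ≡⟨ concatMap-concatMap (λ s → concatMap (s ·_) w) (λ p → concatMap (p ·_) v) u ⟩
    concatMap (λ p → concatMap (p ·_) v ⧢ w) u
      ≡⟨ List.concatMap-cong (λ p → concatMap-concatMap (λ s → concatMap (s ·_) w) (p ·_) v) u ⟩
    concatMap (λ p → concatMap (λ q → (p · q) ⧢ w) v) u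
      ≈⟨ concatMap-cong-≋ (λ p → concatMap-cong-≋ (λ q → ·-⧢-assoc p q w) v) u ⟩
    concatMap (λ p → concatMap (λ q → concatMap (p ·_) (concatMap (q ·_) w)) v) u
      ≡⟨ List.concatMap-cong (λ p → concatMap-concatMap (p ·_) (λ q → concatMap (q ·_) w) v) u ⟨
    u ⧢ (v ⧢ w) ∎

  Rop-as-filter : ∀ u → Rop u ≡ filterᵇ (startsWith1 ∘ proj₂) u
  Rop-as-filter []            = ≡.refl
  Rop-as-filter ((a , w) ∷ u) with startsWith1 w
  ... | true  = cong ((a , w) ∷_) (Rop-as-filter u)
  ... | false = Rop-as-filter u

  Rop-⊕ : ∀ u v → Rop (u ⊕ v) ≡ Rop u ⊕ Rop v
  Rop-⊕ u v = ≡.trans (Rop-as-filter (u ⊕ v)) (≡.trans (List.filter-++ _ u v)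
    (≡.sym (cong₂ _⊕_ (Rop-as-filter u) (Rop-as-filter v))))

  Rop-↭ : ∀ {u v} → u ↭ v → Rop u ↭ Rop v
  Rop-↭ {u} {v} u↭v = ≡.subst₂ _↭_ (≡.sym (Rop-as-filter u)) (≡.sym (Rop-as-filter v)) (filter-↭ _ u↭v)

  Rop-⊖ : ∀ u → Rop (⊖ u) ≡ ⊖ Rop u
  Rop-⊖ []            = ≡.refl
  Rop-⊖ ((a , w) ∷ u) with startsWith1 w
  ... | true  = cong ((- a , w) ∷_) (Rop-⊖ u)
  ... | false = Rop-⊖ u

  Rop-⊕-⊖ : ∀ u v x → Rop (u ⊕ v ⊖ x) ≡ Rop u ⊕ Rop v ⊖ Rop x
  Rop-⊕-⊖ u v x = ≡.trans (Rop-⊕ (u ⊕ v) (⊖ x)) (cong₂ _⊕_ (Rop-⊕ u v) (Rop-⊖ x))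

  Rop-homogeneous : ∀ {b u} → All (λ m → startsWith1 (proj₂ m) ≡ b) u → Rop u ≡ (if b then u else [])
  Rop-homogeneous {true}  []                             = ≡.refl
  Rop-homogeneous {false} []                             = ≡.refl
  Rop-homogeneous {true}  {(a , w) ∷ _} (w≡b ∷ ms) rewrite w≡b = cong ((a , w) ∷_) (Rop-homogeneous ms)
  Rop-homogeneous {false} {(a , w) ∷ _} (w≡b ∷ ms) rewrite w≡b = Rop-homogeneous ms

  record IsAdditive (f : Elem → Elem) : Set c where
    field
      []-homo : f [] ≡ []
      ⊕-homo  : ∀ u v → f (u ⊕ v) ↭ f u ⊕ f v

  additive-ext : ∀ {f g} → IsAdditive f → IsAdditive g →
    (∀ p → f [ p ] ≋ g [ p ]) → ∀ u → f u ≋ g u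
  additive-ext {f} {g} F G f≋g []      = begin
    f [] ≡⟨ IsAdditive.[]-homo F ⟩
    []   ≡⟨ IsAdditive.[]-homo G ⟨
    g [] ∎
  additive-ext {f} {g} F G f≋g (p ∷ u) = begin
    f (p ∷ u)          ≈⟨ ↭⇒≋ (IsAdditive.⊕-homo F [ p ] u) ⟩
    f [ p ] ⊕ f u      ≈⟨ ⊕-cong (f≋g p) (additive-ext F G f≋g u) ⟩
    g [ p ] ⊕ g u      ≈⟨ ↭⇒≋ (IsAdditive.⊕-homo G [ p ] u) ⟨
    g (p ∷ u)          ∎

  ⊕-additive : ∀ {f g} → IsAdditive f → IsAdditive g → IsAdditive (λ u → f u ⊕ g u)
  ⊕-additive {f} {g} F G = record
    { []-homo = cong₂ _⊕_ F.[]-homo G.[]-homo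
    ; ⊕-homo  = λ u v → ↭-trans (++⁺ (F.⊕-homo u v) (G.⊕-homo u v)) (++-interchange (f u) (f v) (g u) (g v))
    }
    where
    module F = IsAdditive F
    module G = IsAdditive G

  ⊖-additive : ∀ {f g} → IsAdditive f → IsAdditive g → IsAdditive (λ u → f u ⊖ g u)
  ⊖-additive {f} {g} F G = ⊕-additive F (record
    { []-homo = cong ⊖_ G.[]-homo
    ; ⊕-homo  = λ u v → ↭-trans (map⁺ _ (G.⊕-homo u v)) (↭-reflexive (List.map-++ _ (g u) (g v)))
    })
    where
    module G = IsAdditive G

  ∘-additive : ∀ {f g} → (∀ {u v} → u ↭ v → f u ↭ f v) → IsAdditive f → IsAdditive g → IsAdditive (f ∘ g)
  ∘-additive {f} {g} f-↭ F G = record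
    { []-homo = ≡.trans (cong f G.[]-homo) F.[]-homo
    ; ⊕-homo  = λ u v → ↭-trans (f-↭ (G.⊕-homo u v)) (F.⊕-homo (g u) (g v))
    }
    where
    module F = IsAdditive F
    module G = IsAdditive G

  id-additive : IsAdditive (λ u → u)
  id-additive = record { []-homo = ≡.refl ; ⊕-homo = λ _ _ → ↭-refl }

  Rop-additive : IsAdditive Rop
  Rop-additive = record { []-homo = ≡.refl ; ⊕-homo = λ u v → ↭-reflexive (Rop-⊕ u v) }

  ⧢-additiveˡ : ∀ v → IsAdditive (_⧢ v)
  ⧢-additiveˡ v = record { []-homo = ≡.refl ; ⊕-homo = λ u u′ → ↭-reflexive (List.concatMap-++ _ u u′) }

  ⧢-additiveʳ : ∀ u → IsAdditive (u ⧢_)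
  ⧢-additiveʳ u = record
    { []-homo = concatMap-nil u
    ; ⊕-homo  = λ v v′ → ↭-trans
        (↭-reflexive (List.concatMap-cong (λ p → List.concatMap-++ (p ·_) v v′) u))
        (concatMap-++-pointwise (λ p → concatMap (p ·_) v) (λ p → concatMap (p ·_) v′) u)
    }

  ⧢-↭ˡ : ∀ w {u v} → u ↭ v → u ⧢ w ↭ v ⧢ w
  ⧢-↭ˡ w = concatMap-↭ (λ p → concatMap (p ·_) w)

  ⧢-↭ʳ : ∀ u {v w} → v ↭ w → u ⧢ v ↭ u ⧢ w
  ⧢-↭ʳ u v↭w = concatMap-cong-↭ (λ p → concatMap-↭ (p ·_) v↭w) u

  ⧢-identityˡ : ∀ u → 𝟙 ⧢ u ≋ u
  ⧢-identityˡ = additive-ext (⧢-additiveʳ 𝟙) id-additive (λ (b , y) → •-congˡ (*-identityˡ b) [ y ])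

  ⧢-monomials : ∀ p q → [ p ] ⧢ [ q ] ≡ p · q
  ⧢-monomials p q = ≡.trans (List.++-identityʳ _) (List.++-identityʳ (p · q))

  Rop-⧢-monomials : ∀ {b} p q → startsWith1 (proj₂ p) ≡ b → startsWith1 (proj₂ q) ≡ b →
    Rop ([ p ] ⧢ [ q ]) ≡ (if b then [ p ] ⧢ [ q ] else [])
  Rop-⧢-monomials p@(_ , x) q@(_ , y) x≡b y≡b rewrite ⧢-monomials p q =
    Rop-homogeneous (All.map⁺ (shuffle-startsWith1 x y x≡b y≡b))

  module _ (p q : Carrier × Word) where

    private
      pq : Elem
      pq = [ p ] ⧢ [ q ]

    rota-baxter-monomials : Rop [ p ] ⧢ Rop [ q ] ≋ Rop (Rop [ p ] ⧢ [ q ] ⊕ [ p ] ⧢ Rop [ q ] ⊖ [ p ] ⧢ [ q ])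
    rota-baxter-monomials with startsWith1 (proj₂ p) in p₁ | startsWith1 (proj₂ q) in q₁
    ... | true  | true  = begin
      pq                        ≈⟨ ⊕-⊖-cancelʳ pq pq ⟨
      pq ⊕ pq ⊖ pq              ≡⟨ cong (λ r → r ⊕ r ⊖ r) (Rop-⧢-monomials p q p₁ q₁) ⟨
      Rop pq ⊕ Rop pq ⊖ Rop pq  ≡⟨ Rop-⊕-⊖ pq pq pq ⟨
      Rop (pq ⊕ pq ⊖ pq)        ∎
    ... | true  | false = begin
      []                        ≈⟨ ⊕-⊖-cancelˡ (Rop pq) [] ⟨
      Rop pq ⊕ [] ⊖ Rop pq      ≡⟨ Rop-⊕-⊖ pq [] pq ⟨
      Rop (pq ⊕ [] ⊖ pq)        ∎
    ... | false | true  = begin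
      []                        ≈⟨ ⊕-⊖-cancelʳ [] (Rop pq) ⟨
      Rop pq ⊖ Rop pq           ≡⟨ Rop-⊕-⊖ [] pq pq ⟨
      Rop (pq ⊖ pq)             ∎
    ... | false | false = begin
      []                        ≡⟨ cong ⊖_ (Rop-⧢-monomials p q p₁ q₁) ⟨
      ⊖ Rop pq                  ≡⟨ Rop-⊖ pq ⟨
      Rop (⊖ pq)                ∎

  rota-baxter : ∀ u v → Rop u ⧢ Rop v ≋ Rop (Rop u ⧢ v ⊕ u ⧢ Rop v ⊖ u ⧢ v)
  rota-baxter u v = additive-ext (lhsˡ v) (rhsˡ v)
    (λ p → additive-ext (lhsʳ [ p ]) (rhsʳ [ p ]) (rota-baxter-monomials p) v) u
    where
    lhsˡ : ∀ v → IsAdditive (λ u → Rop u ⧢ Rop v)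
    lhsˡ v = ∘-additive (⧢-↭ˡ (Rop v)) (⧢-additiveˡ (Rop v)) Rop-additive
    lhsʳ : ∀ u → IsAdditive (λ v → Rop u ⧢ Rop v)
    lhsʳ u = ∘-additive (⧢-↭ʳ (Rop u)) (⧢-additiveʳ (Rop u)) Rop-additive
    rhsˡ : ∀ v → IsAdditive (λ u → Rop (Rop u ⧢ v ⊕ u ⧢ Rop v ⊖ u ⧢ v))
    rhsˡ v = ∘-additive Rop-↭ Rop-additive (⊖-additive
      (⊕-additive (∘-additive (⧢-↭ˡ v) (⧢-additiveˡ v) Rop-additive) (⧢-additiveˡ (Rop v)))
      (⧢-additiveˡ v))
    rhsʳ : ∀ u → IsAdditive (λ v → Rop (Rop u ⧢ v ⊕ u ⧢ Rop v ⊖ u ⧢ v))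
    rhsʳ u = ∘-additive Rop-↭ Rop-additive (⊖-additive
      (⊕-additive (⧢-additiveʳ (Rop u)) (∘-additive (⧢-↭ʳ u) (⧢-additiveʳ u) Rop-additive))
      (⧢-additiveʳ u))

mainTheorem9 : ∀ {c ℓ : Level} (K : CommutativeRing c ℓ) → let open Hsh K in
    ((u v w : Elem) → (u ⧢ v) ⧢ w ≈H u ⧢ (v ⧢ w))
    × ((u v : Elem) → u ⧢ v ≈H v ⧢ u)
    × ((u : Elem) → 𝟙 ⧢ u ≈H u)
    × ((u w : Elem) → Rop u ⧢ Rop w ≈H Rop (Rop u ⧢ w ⊕ u ⧢ Rop w ⊖ u ⧢ w))
mainTheorem9 K =
    (λ u v w → ≋⇒≈H (⧢-assoc K u v w))
  , (λ u v → ≋⇒≈H (⧢-comm K u v))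
  , (λ u → ≋⇒≈H (⧢-identityˡ K u))
  , (λ u w → ≋⇒≈H (rota-baxter K u w))
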